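{- Let $s\ge 1$ be an integer and let $G$ be a finite simple undirected graph such that the $s$-shunt intersection graph $A_s(G)$ has at least one vertex. Then $A_s(G)$ is connected if and only if $G$ has exactly one connected component whose detour diameter is at least $s+1$.
   Context: For an integer $s\ge1$, an $s$-arc on distinct vertices of $G$ is a sequence $(v_0,v_1,\dots,v_s)$ of pairwise distinct vertices with $v_i v_{i+1}\in E(G)$ for $0\le i<s$. Such an $s$-arc $\alpha=(v_0,\dots,v_s)$ can be shunted onto the $s$-arc $\beta$ if there is an $(s+1)$-arc on distinct vertices $(v_0,v_1,\dots,v_s,v_{s+1})$ with $\beta=(v_1,\dots,v_{s+1})$. The $s$-shunt intersection graph $A_s(G)$ has as vertex set the $s$-arcs on distinct vertices of $G$ that can be shunted onto some other $s$-arc on distinct vertices of $G$; two distinct vertices of $A_s(G)$ are adjacent iff the corresponding $s$-arcs have at least one vertex of $G$ in common. The detour distance between two vertices is the length (number of edges) of a longest path between them; the detour diameter of a connected graph is the maximum detour distance over all pairs of its vertices (i.e., the length of a longest path). -}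

module Defs where

open import Level using (0ℓ)
open import Data.Nat using (ℕ; suc; _≤_)
open import Data.Fin using (Fin; inject₁) renaming (suc to fsuc)
open import Data.Product using (Σ; ∃; _×_; _,_; proj₁)
open import Relation.Nullary using (¬_)
open import Relation.Binary using (Rel; Decidable; Symmetric; Irreflexive)
open import Relation.Binary.PropositionalEquality using (_≡_)
open import Relation.Binary.Construct.Closure.ReflexiveTransitive using (Star)
open import Function.Definitions using (Injective)

record Graph (n : ℕ) : Set₁ where
  field
    Adj     : Rel (Fin n) 0ℓ
    adj?    : Decidable Adj
    sym     : Symmetric Adj
    irrefl  : Irreflexive _≡_ Adj
open Graph public

module _ {n : ℕ} (G : Graph n) where

  record Arc (s : ℕ) : Set where
    constructor arc
    field
      vtx  : Fin (suc s) → Fin n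
      inj  : Injective _≡_ _≡_ vtx
      step : ∀ (i : Fin s) → Adj G (vtx (inject₁ i)) (vtx (fsuc i))
  open Arc public

  ShuntsOnto : ∀ {s} → Arc s → Arc s → Set
  ShuntsOnto {s} α β = Σ (Arc (suc s)) λ γ →
    (∀ i → vtx γ (inject₁ i) ≡ vtx α i) × (∀ i → vtx γ (fsuc i) ≡ vtx β i)

  SameArc : ∀ {s} → Arc s → Arc s → Set
  SameArc α β = ∀ i → vtx α i ≡ vtx β i

  Shuntable : (s : ℕ) → Arc s → Set
  Shuntable s α = ∃ λ (β : Arc s) → ¬ SameArc α β × ShuntsOnto α β

  AVertex : ℕ → Set
  AVertex s = Σ (Arc s) (Shuntable s)

  AAdj : (s : ℕ) → Rel (AVertex s) 0ℓ
  AAdj s (α , _) (β , _) =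
    ¬ SameArc α β × ∃ λ i → ∃ λ j → vtx α i ≡ vtx β j

  ASConnected : ℕ → Set
  ASConnected s = ∀ (a b : AVertex s) → Star (AAdj s) a b

  Reach : Rel (Fin n) 0ℓ
  Reach = Star (Adj G)

  -- the connected component of v has detour diameter ≥ k:
  -- it contains a path (an m-arc on distinct vertices) of length m ≥ k
  DetourDiamAtLeast : Fin n → ℕ → Set
  DetourDiamAtLeast v k = ∃ λ m → k ≤ m × Σ (Arc m) λ α → ∀ i → Reach v (vtx α i)

  ExactlyOneLongComponent : ℕ → Set
  ExactlyOneLongComponent k = ∃ λ v → DetourDiamAtLeast v k ×
    (∀ w → DetourDiamAtLeast w k → Reach v w)

-- Every vertex of A_s(G) is the initial s-arc of a path of length s + 1. On the other hand, on a path P of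
-- length at least s + 1 the windows of s + 1 consecutive vertices, and those of its reverse, give
-- vertices of A_s(G); as s ≥ 1 consecutive windows overlap, so they are all A_s(G)-connected, and every
-- vertex of P lies in one of them. Thus A_s(G)-connectivity confines all long paths to one component
-- of G. Conversely, let P and Q be long paths in one component. If they are disjoint, take a path B
-- from P to Q meeting P only at its start and Q only at its end; B together with the longer halves of
-- P and Q at its endpoints is a long path R. Now P and R share a vertex, which lies in windows of both,
-- and so do Q and R; hence the windows of P and Q are A_s(G)-connected.

module Submission where

open import Level using (0ℓ)
open import Data.Nat using (ℕ; zero; suc; _+_; _∸_; _≤_; _<_; z≤n; s≤s; _≤?_)
open import Data.Nat.Properties
open import Data.Nat.DivMod using (_mod_; m<n⇒m%n≡m)
open import Data.Fin using (Fin; toℕ; inject₁; fromℕ; fromℕ<) renaming (zero to fzero)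
open import Data.Fin.Properties
  using (toℕ-injective; toℕ-inject₁; toℕ-fromℕ; toℕ-fromℕ<; toℕ<n; all?) renaming (_≟_ to _≟ᶠ_)
open import Data.Product using (Σ; ∃; _×_; _,_; proj₁)
open import Data.Sum using (_⊎_; inj₁; inj₂)
open import Data.Empty using (⊥-elim)
open import Function.Base using (_∘_)
open import Function.Bundles using (_⇔_; mk⇔)
open import Relation.Nullary using (¬_; Dec; yes; no; contradiction)
open import Relation.Nullary.Decidable using (map′)
open import Relation.Unary using (Pred) renaming (Decidable to Decidable₁)
open import Relation.Binary using (Rel)
open import Relation.Binary.PropositionalEquality
  using (_≡_; _≢_; refl; sym; trans; cong; cong₂; subst; subst₂; module ≡-Reasoning)
open import Relation.Binary.Construct.Closure.ReflexiveTransitive as Star using (Star; ε; _◅_; _◅◅_)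

open import Defs hiding (sym)

lastIndex : ∀ {P : Pred ℕ 0ℓ} → Decidable₁ P → ∀ k → P 0 →
            ∃ λ a → a ≤ k × P a × (∀ {i} → a < i → i ≤ k → ¬ P i)
lastIndex P? zero P0 = 0 , z≤n , P0 , λ 0<i i≤0 → contradiction i≤0 (<⇒≱ 0<i)
lastIndex P? (suc k) P0 with P? (suc k) | lastIndex P? k P0
... | yes Pk+1 | _ = suc k , ≤-refl , Pk+1 , λ k+1<i i≤k+1 → contradiction i≤k+1 (<⇒≱ k+1<i)
... | no ¬Pk+1 | a , a≤k , Pa , noneAfter = a , m≤n⇒m≤1+n a≤k , Pa , noneAfter′
  where
  noneAfter′ : ∀ {i} → a < i → i ≤ suc k → ¬ _
  noneAfter′ a<i i≤k+1 with m≤n⇒m<n∨m≡n i≤k+1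
  ... | inj₁ i<k+1 = noneAfter a<i (≤-pred i<k+1)
  ... | inj₂ refl  = ¬Pk+1

-- f on 0, …, k and g from k + 1 on: the concatenation of two paths whose junction f k = g 0 is shared.
splice : ∀ {A : Set} → ℕ → (ℕ → A) → (ℕ → A) → ℕ → A
splice zero    f g zero    = f zero
splice zero    f g (suc t) = g (suc t)
splice (suc k) f g zero    = f zero
splice (suc k) f g (suc t) = splice k (f ∘ suc) g t

splice-≤ : ∀ {A : Set} k (f g : ℕ → A) {t} → t ≤ k → splice k f g t ≡ f t
splice-≤ zero    f g z≤n      = refl
splice-≤ (suc k) f g z≤n      = refl
splice-≤ (suc k) f g (s≤s t≤k) = splice-≤ k (f ∘ suc) g t≤k

splice-> : ∀ {A : Set} k (f g : ℕ → A) u → splice k f g (suc (k + u)) ≡ g (suc u)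
splice-> zero    f g u = refl
splice-> (suc k) f g u = splice-> k (f ∘ suc) g u

splice-linked : ∀ {A : Set} (R : Rel A 0ℓ) k {m} (f g : ℕ → A) → f k ≡ g 0 →
  (∀ {i} → i < k → R (f i) (f (suc i))) → (∀ {i} → i < m → R (g i) (g (suc i))) →
  ∀ {i} → i < k + m → R (splice k f g i) (splice k f g (suc i))
splice-linked R zero    f g f0≡g0 _ g-linked {zero}  0<m = subst (λ x → R x (g 1)) (sym f0≡g0) (g-linked 0<m)
splice-linked R zero    f g f0≡g0 _ g-linked {suc i} i<m = g-linked i<m
splice-linked R (suc k) f g fk≡g0 f-linked _ {zero} _ =
  subst (R (f 0)) (sym (splice-≤ k (f ∘ suc) g z≤n)) (f-linked (s≤s z≤n))
splice-linked R (suc k) f g fk≡g0 f-linked g-linked {suc i} (s≤s i<k+m) =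
  splice-linked R k (f ∘ suc) g fk≡g0 (λ { (s≤s i<k) → f-linked (s≤s (s≤s i<k)) }) g-linked i<k+m

data SplitAt (k : ℕ) : ℕ → Set where
  left  : ∀ {t} → t ≤ k → SplitAt k t
  right : ∀ u → SplitAt k (suc (k + u))

splitAt : ∀ k t → SplitAt k t
splitAt zero    zero    = left z≤n
splitAt zero    (suc t) = right t
splitAt (suc k) zero    = left z≤n
splitAt (suc k) (suc t) with splitAt k t
... | left t≤k = left (s≤s t≤k)
... | right u  = right u

toℕ-mod : ∀ {i m} → i ≤ m → toℕ (i mod suc m) ≡ i
toℕ-mod i≤m = trans (toℕ-fromℕ< _) (m<n⇒m%n≡m (s≤s i≤m))

mod-toℕ : ∀ {m} (x : Fin (suc m)) → toℕ x mod suc m ≡ x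
mod-toℕ x = toℕ-injective (toℕ-mod (≤-pred (toℕ<n x)))

<⇒≤∸1 : ∀ {m n} → m < n → m ≤ n ∸ 1
<⇒≤∸1 {m} {n} m<n = subst (m ≤_) (pred[m∸n]≡m∸[1+n] n 0) (<⇒≤pred m<n)

sum-bound : ∀ {l a b} → l ≤ a + a → l ≤ b + b → l ≤ a + b
sum-bound {a = a} {b} l≤2a l≤2b with ≤-total a b
... | inj₁ a≤b = ≤-trans l≤2a (+-monoʳ-≤ a a≤b)
... | inj₂ b≤a = ≤-trans l≤2b (+-monoˡ-≤ b b≤a)

module Paths {n : ℕ} (G : Graph n) where

  private
    E = Adj G

  -- A path of length len visits at 0, …, at len; the values of at beyond len are irrelevant.
  record Path : Set where
    field
      len          : ℕ
      at           : ℕ → Fin n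
      at-injective : ∀ {i j} → i ≤ len → j ≤ len → at i ≡ at j → i ≡ j
      at-adjacent  : ∀ {i} → i < len → E (at i) (at (suc i))

  open Path public

  start end : Path → Fin n
  start p = at p 0
  end   p = at p (len p)

  _∈ₚ_ : Fin n → Path → Set
  x ∈ₚ p = ∃ λ i → i ≤ len p × at p i ≡ x

  _⊆ₚ_ : Path → Path → Set
  p ⊆ₚ q = ∀ {x} → x ∈ₚ p → x ∈ₚ q

  Meet : Path → Path → Set
  Meet p q = ∃ λ x → x ∈ₚ p × x ∈ₚ q

  start∈ : ∀ p → start p ∈ₚ p
  start∈ p = 0 , z≤n , refl

  end∈ : ∀ p → end p ∈ₚ p
  end∈ p = len p , ≤-refl , refl

  _∈ₚ?_ : ∀ x p → Dec (x ∈ₚ p)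
  x ∈ₚ? p = map′ (λ (i , i<1+len , e) → i , ≤-pred i<1+len , e)
                 (λ (i , i≤len , e) → i , s≤s i≤len , e)
                 (anyUpTo? (λ i → at p i ≟ᶠ x) (suc (len p)))

  meet? : ∀ p q → Dec (Meet p q)
  meet? p q = map′ (λ (i , i<1+len , pi∈q) → at p i , (i , ≤-pred i<1+len , refl) , pi∈q)
                   (λ (x , (i , i≤len , pi≡x) , x∈q) → i , s≤s i≤len , subst (_∈ₚ q) (sym pi≡x) x∈q)
                   (anyUpTo? (λ i → at p i ∈ₚ? q) (suc (len p)))

  point : Fin n → Path
  point x = record { len = 0 ; at = λ _ → x ; at-injective = λ { z≤n z≤n _ → refl } ; at-adjacent = λ () }

  reverse : Path → Path
  reverse p = record
    { len = len p ; at = λ i → at p (len p ∸ i) ; at-injective = injective ; at-adjacent = adjacent }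
    where
    injective : ∀ {i j} → i ≤ len p → j ≤ len p → at p (len p ∸ i) ≡ at p (len p ∸ j) → i ≡ j
    injective {i} {j} i≤ j≤ e = begin
      i                  ≡⟨ m∸[m∸n]≡n i≤ ⟨
      len p ∸ (len p ∸ i) ≡⟨ cong (len p ∸_) (at-injective p (m∸n≤m _ i) (m∸n≤m _ j) e) ⟩
      len p ∸ (len p ∸ j) ≡⟨ m∸[m∸n]≡n j≤ ⟩
      j                  ∎
      where open ≡-Reasoning
    adjacent : ∀ {i} → i < len p → E (at p (len p ∸ i)) (at p (len p ∸ suc i))
    adjacent {i} i<len = subst (λ k → E (at p k) (at p (len p ∸ suc i))) (sym (+-∸-assoc 1 i<len))
      (Graph.sym G (at-adjacent p (subst (_≤ len p) (+-∸-assoc 1 i<len) (m∸n≤m (len p) i))))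

  take : ∀ k (p : Path) → k ≤ len p → Path
  take k p k≤len = record
    { len = k ; at = at p
    ; at-injective = λ i≤k j≤k → at-injective p (≤-trans i≤k k≤len) (≤-trans j≤k k≤len)
    ; at-adjacent = λ i<k → at-adjacent p (≤-trans i<k k≤len) }

  drop : ∀ k (p : Path) → k ≤ len p → Path
  drop k p k≤len = record
    { len = len p ∸ k ; at = λ i → at p (i + k)
    ; at-injective = λ i≤ j≤ e → +-cancelʳ-≡ k _ _ (at-injective p (shift i≤) (shift j≤) e)
    ; at-adjacent = λ i< → at-adjacent p (shift i<) }
    where
    shift : ∀ {i} → i ≤ len p ∸ k → i + k ≤ len p
    shift {i} = m≤o∸n⇒m+n≤o i k≤len

  cons : ∀ x (p : Path) → E x (start p) → ¬ x ∈ₚ p → Path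
  cons x p x~p x∉p = record { len = suc (len p) ; at = at′ ; at-injective = injective ; at-adjacent = adjacent }
    where
    at′ : ℕ → Fin n
    at′ zero    = x
    at′ (suc i) = at p i
    injective : ∀ {i j} → i ≤ suc (len p) → j ≤ suc (len p) → at′ i ≡ at′ j → i ≡ j
    injective {zero}  {zero}  _         _         _ = refl
    injective {zero}  {suc j} _         (s≤s j≤) e = contradiction (j , j≤ , sym e) x∉p
    injective {suc i} {zero}  (s≤s i≤) _         e = contradiction (i , i≤ , e) x∉p
    injective {suc i} {suc j} (s≤s i≤) (s≤s j≤) e = cong suc (at-injective p i≤ j≤ e)
    adjacent : ∀ {i} → i < suc (len p) → E (at′ i) (at′ (suc i))
    adjacent {zero}  _          = x~p
    adjacent {suc i} (s≤s i<len) = at-adjacent p i<len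

  module Join (p q : Path) (p⌣q : end p ≡ start q) (disjoint : ∀ {x} → x ∈ₚ p → x ∈ₚ q → x ≡ start q) where

    private
      k = len p

      right-bound : ∀ {u} → suc (k + u) ≤ k + len q → suc u ≤ len q
      right-bound {u} le = +-cancelˡ-≤ k _ _ (subst (_≤ k + len q) (sym (+-suc k u)) le)

      not-shared : ∀ {i u} → i ≤ k → suc u ≤ len q → at p i ≢ at q (suc u)
      not-shared i≤k 1+u≤ e
        with at-injective q 1+u≤ z≤n (trans (sym e) (disjoint (_ , i≤k , refl) (_ , 1+u≤ , sym e)))
      ... | ()

      injective : ∀ {i j} → i ≤ k + len q → j ≤ k + len q →
                  splice k (at p) (at q) i ≡ splice k (at p) (at q) j → i ≡ j
      injective {i} {j} i≤ j≤ e with splitAt k i | splitAt k j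
      ... | left i≤k | left j≤k = at-injective p i≤k j≤k
            (trans (sym (splice-≤ k (at p) (at q) i≤k)) (trans e (splice-≤ k (at p) (at q) j≤k)))
      ... | left i≤k | right v = contradiction
            (trans (sym (splice-≤ k (at p) (at q) i≤k)) (trans e (splice-> k (at p) (at q) v)))
            (not-shared i≤k (right-bound j≤))
      ... | right u | left j≤k = contradiction
            (trans (sym (splice-≤ k (at p) (at q) j≤k)) (trans (sym e) (splice-> k (at p) (at q) u)))
            (not-shared j≤k (right-bound i≤))
      ... | right u | right v = cong (suc ∘ (k +_)) (suc-injective
            (at-injective q (right-bound i≤) (right-bound j≤)
              (trans (sym (splice-> k (at p) (at q) u)) (trans e (splice-> k (at p) (at q) v)))))

    joined : Path
    joined = record
      { len = k + len q ; at = splice k (at p) (at q) ; at-injective = injective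
      ; at-adjacent = splice-linked E k (at p) (at q) p⌣q (at-adjacent p) (at-adjacent q) }

    joined-start : start joined ≡ start p
    joined-start = splice-≤ k (at p) (at q) z≤n

    ∈-joined⁺ˡ : p ⊆ₚ joined
    ∈-joined⁺ˡ (i , i≤ , e) = i , ≤-trans i≤ (m≤m+n k (len q)) , trans (splice-≤ k (at p) (at q) i≤) e

    ∈-joined⁺ʳ : q ⊆ₚ joined
    ∈-joined⁺ʳ (zero , _ , e) = k , m≤m+n k (len q) , trans (splice-≤ k (at p) (at q) ≤-refl) (trans p⌣q e)
    ∈-joined⁺ʳ (suc u , 1+u≤ , e) =
      suc (k + u) , subst (_≤ k + len q) (+-suc k u) (+-monoʳ-≤ k 1+u≤) , trans (splice-> k (at p) (at q) u) e

    ∈-joined⁻ : ∀ {x} → x ∈ₚ joined → x ∈ₚ p ⊎ x ∈ₚ q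
    ∈-joined⁻ (i , i≤ , e) with splitAt k i
    ... | left i≤k = inj₁ (i , i≤k , trans (sym (splice-≤ k (at p) (at q) i≤k)) e)
    ... | right u  = inj₂ (suc u , right-bound i≤ , trans (sym (splice-> k (at p) (at q) u)) e)

  reverse-⊆ : ∀ p → reverse p ⊆ₚ p
  reverse-⊆ p (i , _ , e) = len p ∸ i , m∸n≤m (len p) i , e

  take-⊆ : ∀ {k} p (k≤ : k ≤ len p) → take k p k≤ ⊆ₚ p
  take-⊆ p k≤ (i , i≤k , e) = i , ≤-trans i≤k k≤ , e

  drop-⊆ : ∀ {k} p (k≤ : k ≤ len p) → drop k p k≤ ⊆ₚ p
  drop-⊆ {k} p k≤ (i , i≤ , e) = i + k , m≤o∸n⇒m+n≤o i k≤ i≤ , e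

  reverse-end : ∀ p → end (reverse p) ≡ start p
  reverse-end p = cong (at p) (n∸n≡0 (len p))

  drop-end : ∀ {k} p (k≤ : k ≤ len p) → end (drop k p k≤) ≡ end p
  drop-end p k≤ = cong (at p) (m∸n+n≡m k≤)

  reach-along : ∀ p {i} → i ≤ len p → Reach G (start p) (at p i)
  reach-along p {zero}  _       = ε
  reach-along p {suc i} 1+i≤len = reach-along p (≤-trans (n≤1+n i) 1+i≤len) ◅◅ (at-adjacent p 1+i≤len ◅ ε)

  path-connected : ∀ p {i j} → i ≤ len p → j ≤ len p → Reach G (at p i) (at p j)
  path-connected p i≤ j≤ = Star.reverse (Graph.sym G) (reach-along p i≤) ◅◅ reach-along p j≤

  MeetsOnlyAtStart MeetsOnlyAtEnd : Pred (Fin n) 0ℓ → Path → Set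
  MeetsOnlyAtStart S p = ∀ {x} → x ∈ₚ p → S x → x ≡ start p
  MeetsOnlyAtEnd   T p = ∀ {x} → x ∈ₚ p → T x → x ≡ end p

  path-into : ∀ {T} → Decidable₁ T → ∀ {x y} → Reach G x y → T y →
              Σ Path λ p → start p ≡ x × T (end p) × MeetsOnlyAtEnd T p
  path-into T? {x} ε Ty = point x , refl , Ty , λ (_ , _ , e) _ → sym e
  path-into {T} T? {x} (x~x′ ◅ x′⇝y) Ty with T? x | path-into T? x′⇝y Ty
  ... | yes Tx | _ = point x , refl , Tx , λ (_ , _ , e) _ → sym e
  ... | no ¬Tx | p , refl , T-end , onlyEnd with x ∈ₚ? p
  ...   | yes (j , j≤ , pj≡x) = drop j p j≤ , pj≡x , subst T (sym (drop-end p j≤)) T-end ,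
          λ x∈ Tx → trans (onlyEnd (drop-⊆ p j≤ x∈) Tx) (sym (drop-end p j≤))
  ...   | no x∉p = cons x p x~x′ x∉p , refl , T-end , onlyEnd′
    where
    onlyEnd′ : MeetsOnlyAtEnd T (cons x p x~x′ x∉p)
    onlyEnd′ (zero  , _ , e)         Tz = contradiction (subst T (sym e) Tz) ¬Tx
    onlyEnd′ (suc i , s≤s i≤len , e) Tz = onlyEnd (i , i≤len , e) Tz

  record Bridge (S T : Pred (Fin n) 0ℓ) : Set where
    field
      path       : Path
      start∈S    : S (start path)
      end∈T      : T (end path)
      only-start : MeetsOnlyAtStart S path
      only-end   : MeetsOnlyAtEnd T path

  -- Walk into T, then keep only the part after the last visit of S.
  bridge : ∀ {S T} → Decidable₁ S → Decidable₁ T → ∀ {x y} → S x → T y → Reach G x y → Bridge S T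
  bridge {S} {T} S? T? Sx Ty x⇝y with path-into T? x⇝y Ty
  ... | p , refl , T-end , onlyEnd with lastIndex (S? ∘ at p) (len p) Sx
  ... | a , a≤len , Sa , noneAfter = record
    { path = drop a p a≤len
    ; start∈S = Sa
    ; end∈T = subst T (sym (drop-end p a≤len)) T-end
    ; only-start = onlyStart
    ; only-end = λ x∈ Tx → trans (onlyEnd (drop-⊆ p a≤len x∈) Tx) (sym (drop-end p a≤len)) }
    where
    onlyStart : MeetsOnlyAtStart S (drop a p a≤len)
    onlyStart (zero  , _  , e) _  = sym e
    onlyStart (suc i , i≤ , e) Sx = contradiction (subst S (sym e) Sx)
      (noneAfter (m<n+m a {suc i} (s≤s z≤n)) (m≤o∸n⇒m+n≤o (suc i) a≤len i≤))

  longer-half : ∀ (p : Path) {x} → x ∈ₚ p → Σ Path λ h → start h ≡ x × len p ≤ len h + len h × h ⊆ₚ p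
  longer-half p {x} (i , i≤len , refl) with len p ≤? i + i
  ... | yes len≤2i = reverse (take i p i≤len) , refl , len≤2i , take-⊆ p i≤len ∘ reverse-⊆ (take i p i≤len)
  ... | no  len≰2i = drop i p i≤len , refl , len≤2[len∸i] , drop-⊆ p i≤len
    where
    len≤2[len∸i] : len p ≤ (len p ∸ i) + (len p ∸ i)
    len≤2[len∸i] = begin
      len p                   ≡⟨ m+[n∸m]≡n i≤len ⟨
      i + (len p ∸ i)         ≤⟨ +-monoˡ-≤ (len p ∸ i) (m+n≤o⇒m≤o∸n i (<⇒≤ (≰⇒> len≰2i))) ⟩
      (len p ∸ i) + (len p ∸ i) ∎
      where open ≤-Reasoning

  -- Glue the longer half of p at the bridge's start, the bridge, and the longer half of q at its end.
  long-path-across : ∀ {l} (p q : Path) → l ≤ len p → l ≤ len q → ¬ Meet p q → Bridge (_∈ₚ p) (_∈ₚ q) →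
                     Σ Path λ r → l ≤ len r × Meet p r × Meet q r
  long-path-across {l} p q l≤p l≤q p∩q=∅ b
    with longer-half p (Bridge.start∈S b) | longer-half q (Bridge.end∈T b)
  ... | h₁ , h₁-start , p≤2h₁ , h₁⊆p | h₂ , h₂-start , q≤2h₂ , h₂⊆q =
    R.joined , l≤r , (start B , start∈S , B⊆r (start∈ B)) , (end B , end∈T , B⊆r (end∈ B))
    where
    open Bridge b renaming (path to B)
    B-meets-h₂-at-end : ∀ {x} → x ∈ₚ B → x ∈ₚ h₂ → x ≡ start h₂
    B-meets-h₂-at-end x∈B x∈h₂ = trans (only-end x∈B (h₂⊆q x∈h₂)) (sym h₂-start)
    module Tail = Join B h₂ (sym h₂-start) B-meets-h₂-at-end
    only-junction : ∀ {x} → x ∈ₚ reverse h₁ → x ∈ₚ Tail.joined → x ≡ start Tail.joined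
    only-junction x∈h₁ x∈tail with Tail.∈-joined⁻ x∈tail
    ... | inj₁ x∈B  = trans (only-start x∈B (h₁⊆p (reverse-⊆ h₁ x∈h₁))) (sym Tail.joined-start)
    ... | inj₂ x∈h₂ = ⊥-elim (p∩q=∅ (_ , h₁⊆p (reverse-⊆ h₁ x∈h₁) , h₂⊆q x∈h₂))
    h₁⌣tail : end (reverse h₁) ≡ start Tail.joined
    h₁⌣tail = trans (reverse-end h₁) (trans h₁-start (sym Tail.joined-start))
    module R = Join (reverse h₁) Tail.joined h₁⌣tail only-junction
    B⊆r : B ⊆ₚ R.joined
    B⊆r = R.∈-joined⁺ʳ ∘ Tail.∈-joined⁺ˡ
    l≤r : l ≤ len R.joined
    l≤r = ≤-trans (sum-bound {a = len h₁} {len h₂} (≤-trans l≤p p≤2h₁) (≤-trans l≤q q≤2h₂))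
                  (+-monoʳ-≤ (len h₁) (m≤n+m (len h₂) (len B)))

  long-path-meeting-both : ∀ {l} (p q : Path) → l ≤ len p → l ≤ len q → Reach G (start p) (start q) →
                           Σ Path λ r → l ≤ len r × Meet p r × Meet q r
  long-path-meeting-both p q l≤p l≤q p⇝q with meet? p q
  ... | yes (x , x∈p , x∈q) = p , l≤p , (start p , start∈ p , start∈ p) , (x , x∈q , x∈p)
  ... | no  p∩q=∅ =
    long-path-across p q l≤p l≤q p∩q=∅ (bridge (_∈ₚ? p) (_∈ₚ? q) (start∈ p) (start∈ q) p⇝q)

  arcPath : ∀ {m} → Arc G m → Path
  arcPath {m} α = record
    { len = m ; at = λ i → vtx α (i mod suc m) ; at-injective = injective ; at-adjacent = adjacent }
    where
    injective : ∀ {i j} → i ≤ m → j ≤ m → vtx α (i mod suc m) ≡ vtx α (j mod suc m) → i ≡ j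
    injective i≤m j≤m e = trans (sym (toℕ-mod i≤m)) (trans (cong toℕ (inj α e)) (toℕ-mod j≤m))
    adjacent : ∀ {i} → i < m → E (vtx α (i mod suc m)) (vtx α (suc i mod suc m))
    adjacent i<m = subst₂ (λ x y → E (vtx α x) (vtx α y))
      (toℕ-injective (trans (toℕ-inject₁ _) (trans (toℕ-fromℕ< i<m) (sym (toℕ-mod (<⇒≤ i<m))))))
      (toℕ-injective (trans (cong suc (toℕ-fromℕ< i<m)) (sym (toℕ-mod i<m))))
      (step α (fromℕ< i<m))

  arcPath-at : ∀ {m} (α : Arc G m) x → at (arcPath α) (toℕ x) ≡ vtx α x
  arcPath-at α x = cong (vtx α) (mod-toℕ x)

  arc-connected : ∀ {m} (α : Arc G m) x y → Reach G (vtx α x) (vtx α y)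
  arc-connected α x y = subst₂ (Reach G) (arcPath-at α x) (arcPath-at α y)
    (path-connected (arcPath α) (≤-pred (toℕ<n x)) (≤-pred (toℕ<n y)))

  arcAt : ∀ b m (p : Path) → b + m ≤ len p → Arc G m
  arcAt b m p b+m≤len = arc (λ x → at p (b + toℕ x)) injective adjacent
    where
    bound : ∀ (x : Fin (suc m)) → b + toℕ x ≤ len p
    bound x = ≤-trans (+-monoʳ-≤ b (≤-pred (toℕ<n x))) b+m≤len
    injective : ∀ {x y} → at p (b + toℕ x) ≡ at p (b + toℕ y) → x ≡ y
    injective {x} {y} e = toℕ-injective (+-cancelˡ-≡ b _ _ (at-injective p (bound x) (bound y) e))
    adjacent : ∀ (x : Fin m) → E (at p (b + toℕ (inject₁ x))) (at p (b + suc (toℕ x)))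
    adjacent x = subst₂ (λ i j → E (at p i) (at p j)) (cong (b +_) (sym (toℕ-inject₁ x))) (sym (+-suc b (toℕ x)))
      (at-adjacent p (≤-trans (subst (_≤ b + m) (+-suc b (toℕ x)) (+-monoʳ-≤ b (toℕ<n x))) b+m≤len))

module Shunting {n : ℕ} (G : Graph n) {s : ℕ} (1≤s : 1 ≤ s) where

  open Paths G

  private
    A = AVertex G s

  _~_ : Rel A 0ℓ
  _~_ = Star (AAdj G s)

  ~-sym : ∀ {a b} → a ~ b → b ~ a
  ~-sym = Star.reverse λ (a≢b , i , j , e) → (λ b≡a → a≢b (sym ∘ b≡a)) , j , i , sym e

  _∈ᵃ_ : Fin n → A → Set
  x ∈ᵃ (α , _) = ∃ λ i → vtx α i ≡ x

  Long : Path → Set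
  Long p = suc s ≤ len p

  firstArc : (p : Path) → Long p → A
  firstArc p long = α , β , α≢β , arcAt 0 (suc s) p long , (λ i → cong (at p) (toℕ-inject₁ i)) , (λ _ → refl)
    where
    α = arcAt 0 s p (≤-trans (n≤1+n s) long)
    β = arcAt 1 s p long
    α≢β : ¬ SameArc G α β
    α≢β same with at-injective p z≤n (≤-trans (s≤s z≤n) long) (same fzero)
    ... | ()

  second : Fin (suc s)
  second = fromℕ< (s≤s 1≤s)

  -- Both arcs contain at p 1: the first at index 1, the reversed one at index s.
  first-arcs-of-reverse-adjacent : (p : Path) (tight : len p ≡ suc s) →
    AAdj G s (firstArc p (≤-reflexive (sym tight))) (firstArc (reverse p) (≤-reflexive (sym tight)))
  first-arcs-of-reverse-adjacent p tight =
    distinct , second , fromℕ s , cong (at p) (trans (toℕ-fromℕ< (s≤s 1≤s)) (sym len∸s≡1))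
    where
    len∸s≡1 : len p ∸ toℕ (fromℕ s) ≡ 1
    len∸s≡1 = trans (cong₂ _∸_ tight (toℕ-fromℕ s)) (m+n∸n≡m 1 s)
    long = ≤-reflexive (sym tight)
    distinct : ¬ SameArc G (proj₁ (firstArc p long)) (proj₁ (firstArc (reverse p) long))
    distinct same with trans (at-injective p z≤n ≤-refl (same fzero)) tight
    ... | ()

  extension : A → Arc G (suc s)
  extension (_ , _ , _ , γ , _) = γ

  same-as-extension : ∀ a → SameArc G (proj₁ a) (proj₁ (firstArc (arcPath (extension a)) ≤-refl))
  same-as-extension (α , _ , _ , γ , γ≡α , _) i =
    trans (sym (γ≡α i)) (trans (sym (arcPath-at γ (inject₁ i))) (cong (at (arcPath γ)) (toℕ-inject₁ i)))

  neighbour : ∀ a → ∃ (AAdj G s a)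
  neighbour a with first-arcs-of-reverse-adjacent (arcPath (extension a)) refl
  ... | distinct , i , j , e =
    firstArc (reverse (arcPath (extension a))) ≤-refl ,
    (λ a≡c → distinct (λ k → trans (sym (same k)) (a≡c k))) , i , j , trans (same i) e
    where
    same = same-as-extension a

  -- Adjacency in A_s(G) requires distinct arcs, so if a and b carry the same arc we pass through a neighbour of a.
  sharing-connected : ∀ {x} (a b : A) → x ∈ᵃ a → x ∈ᵃ b → a ~ b
  sharing-connected a b (i , ai≡x) (j , bj≡x) with all? (λ k → vtx (proj₁ a) k ≟ᶠ vtx (proj₁ b) k)
  ... | no  a≢b = (a≢b , i , j , trans ai≡x (sym bj≡x)) ◅ ε
  ... | yes a≡b with neighbour a
  ...   | c , a≢c , k , l , ak≡cl =
    _◅_ {j = c} (a≢c , k , l , ak≡cl)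
      (((λ c≡b → a≢c (λ m → trans (a≡b m) (sym (c≡b m)))) , l , k , trans (sym ak≡cl) (a≡b k)) ◅ ε)

  along : (p : Path) (long : Long p) → ∀ {i} → i ≤ len p → ∃ λ c → at p i ∈ᵃ c × firstArc p long ~ c
  along p long {zero} _ = firstArc p long , (fzero , refl) , ε
  along p long {suc i} 1+i≤len with m≤n⇒m<n∨m≡n long
  ... | inj₁ s<len with along (drop 1 p (≤-trans (s≤s z≤n) long)) (<⇒≤∸1 s<len) (<⇒≤∸1 1+i≤len)
  ...   | c , p[i+1]∈c , tail~c =
    c , subst (_∈ᵃ c) (cong (at p) (+-comm i 1)) p[i+1]∈c ,
    sharing-connected _ _ (second , cong (at p) (toℕ-fromℕ< (s≤s 1≤s))) (fzero , refl) ◅◅ tail~c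
  along p long {suc i} 1+i≤len | inj₂ tight with m≤n⇒m<n∨m≡n 1+i≤len
  ... | inj₁ 1+i<len = firstArc p long , (fromℕ< 1+i<1+s , cong (at p) (toℕ-fromℕ< 1+i<1+s)) , ε
    where
    1+i<1+s = subst (suc i <_) (sym tight) 1+i<len
  ... | inj₂ 1+i≡len = firstArc (reverse p) long , (fzero , cong (at p) (sym 1+i≡len)) ,
    first-arcs-of-reverse-adjacent p (sym tight) ◅ ε

  meeting-connected : (p q : Path) (p-long : Long p) (q-long : Long q) →
                      Meet p q → firstArc p p-long ~ firstArc q q-long
  meeting-connected p q p-long q-long (x , (i , i≤ , pi≡x) , (j , j≤ , qj≡x))
    with along p p-long i≤ | along q q-long j≤
  ... | c , pi∈c , p~c | d , qj∈d , q~d =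
    p~c ◅◅ sharing-connected c d (subst (_∈ᵃ c) pi≡x pi∈c) (subst (_∈ᵃ d) qj≡x qj∈d) ◅◅ ~-sym q~d

  reachable-connected : (p q : Path) (p-long : Long p) (q-long : Long q) →
                        Reach G (start p) (start q) → firstArc p p-long ~ firstArc q q-long
  reachable-connected p q p-long q-long p⇝q with long-path-meeting-both p q p-long q-long p⇝q
  ... | r , r-long , p∩r , q∩r =
    meeting-connected p r p-long r-long p∩r ◅◅ ~-sym (meeting-connected q r q-long r-long q∩r)

  arc-vertices-connected : ∀ {x y} a → x ∈ᵃ a → y ∈ᵃ a → Reach G x y
  arc-vertices-connected (α , _) (i , αi≡x) (j , αj≡y) =
    subst₂ (Reach G) αi≡x αj≡y (arc-connected α i j)

  ~⇒Reach : ∀ {a b x y} → a ~ b → x ∈ᵃ a → y ∈ᵃ b → Reach G x y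
  ~⇒Reach {a} ε x∈a y∈a = arc-vertices-connected a x∈a y∈a
  ~⇒Reach {a} ((_ , i , j , ai≡bj) ◅ b~c) x∈a y∈c =
    arc-vertices-connected a x∈a (i , refl) ◅◅ ~⇒Reach b~c (j , sym ai≡bj) y∈c

  extension-diameter : ∀ a → DetourDiamAtLeast G (vtx (extension a) fzero) (suc s)
  extension-diameter a = suc s , ≤-refl , extension a , arc-connected (extension a) fzero

  to-extension : ∀ a → a ~ firstArc (arcPath (extension a)) ≤-refl
  to-extension a = sharing-connected _ _ (fzero , refl) (fzero , sym (same-as-extension a fzero))

  connected⇒unique-long-component : A → ASConnected G s → ExactlyOneLongComponent G (suc s)
  connected⇒unique-long-component a connected = vtx (extension a) fzero , extension-diameter a , reaches
    where
    reaches : ∀ w → DetourDiamAtLeast G w (suc s) → Reach G (vtx (extension a) fzero) w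
    reaches w (m , 1+s≤m , δ , w⇝δ) =
      ~⇒Reach (connected a (firstArc (arcPath δ) 1+s≤m)) (fzero , same-as-extension a fzero) (fzero , refl)
      ◅◅ Star.reverse (Graph.sym G) (w⇝δ fzero)

  unique-long-component⇒connected : ExactlyOneLongComponent G (suc s) → ASConnected G s
  unique-long-component⇒connected (_ , _ , reaches) a b =
    to-extension a ◅◅ reachable-connected (arcPath (extension a)) (arcPath (extension b)) ≤-refl ≤-refl a⇝b
      ◅◅ ~-sym (to-extension b)
    where
    a⇝b : Reach G (vtx (extension a) fzero) (vtx (extension b) fzero)
    a⇝b = Star.reverse (Graph.sym G) (reaches _ (extension-diameter a)) ◅◅ reaches _ (extension-diameter b)

mainTheorem1 : ∀ (s : ℕ) → 1 ≤ s → ∀ {n : ℕ} (G : Graph n) →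
    AVertex G s →
    (ASConnected G s ⇔ ExactlyOneLongComponent G (suc s))
mainTheorem1 s 1≤s G a = mk⇔ (connected⇒unique-long-component a) unique-long-component⇒connected
  where open Shunting G 1≤s
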